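{- Let $S$ and $T$ be subsets of a metric space $X$ such that $S\subset\lnot T$ and $S$ is open. Then $S\subset -T$.
   Context: Work in Bishop-style constructive mathematics (intuitionistic logic). For a subset $T$ of a metric space $(X,\rho)$: a point $x$ is bounded away from $T$ if there is $r>0$ with $\rho(x,y)\ge r$ for all $y\in T$; the metric complement $-T$ is the set of points bounded away from $T$. The logical complement is $\lnot T=\{x\in X: \forall y\in T\ \lnot(x=y)\}$. -}

module Defs where

open import Level using (Level; _⊔_) renaming (suc to lsuc)
open import Data.Nat as ℕ using (ℕ; suc)
open import Data.Integer as ℤ using (ℤ; +_)
open import Data.Rational.Unnormalised hiding (_⊔_; _⊓_)
open import Data.Rational.Unnormalised.Properties
open import Data.Rational.Unnormalised.Solver
open import Data.Product using (Σ; ∃; _×_; _,_)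
open import Relation.Binary using (Setoid)
open import Relation.Nullary using (¬_)
open import Relation.Binary.PropositionalEquality using (_≡_; refl; cong; sym)

-- Bishop real numbers: regular sequences of rationals.
-- Index k of a sequence stands for Bishop's index n = k + 1, so the
-- regularity condition |x_m - x_n| ≤ 1/m + 1/n (m,n ≥ 1) reads as below.

1/[1+_] : ℕ → ℚᵘ
1/[1+ n ] = mkℚᵘ (+ 1) n

record ℝ : Set where
  constructor mkℝ
  field
    seq : ℕ → ℚᵘ
    reg : ∀ m n → ∣ seq m - seq n ∣ ≤ 1/[1+ m ] + 1/[1+ n ]
open ℝ public

-- 1/(2n) + 1/(2n) = 1/n, with n = k + 1 and 2n = (2k+1)+1
private
  h : ℕ → ℚᵘ
  h k = 1/[1+ suc (2 ℕ.* k) ]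

  half : ∀ k → h k + h k ≃ 1/[1+ k ]
  half k = *≡* (cong +_ (lem k))
    where
    open import Data.Nat.Tactic.RingSolver
    lem : ∀ k → (1 ℕ.* suc (suc (2 ℕ.* k)) ℕ.+ 1 ℕ.* suc (suc (2 ℕ.* k))) ℕ.* suc k
              ≡ 1 ℕ.* (suc (suc (2 ℕ.* k)) ℕ.* suc (suc (2 ℕ.* k)))
    lem = solve-∀

  0≤1/ : ∀ k → 0ℚᵘ ≤ 1/[1+ k ]
  0≤1/ k = *≤* (ℤ.+≤+ ℕ.z≤n)

  open ≤-Reasoning

  reg-neg : (x : ℝ) → ∀ m n → ∣ (- seq x m) - (- seq x n) ∣ ≤ 1/[1+ m ] + 1/[1+ n ]
  reg-neg x m n = begin
    ∣ (- a) - (- b) ∣  ≃⟨ ∣-∣-cong (+-*-Solver.solve 2 (λ a b → (:- a) :+ (:- (:- b)) := :- (a :+ (:- b))) ≃-refl a b) ⟩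
    ∣ - (a - b) ∣      ≡⟨ ∣-p∣≡∣p∣ (a - b) ⟩
    ∣ a - b ∣          ≤⟨ reg x m n ⟩
    1/[1+ m ] + 1/[1+ n ] ∎
    where
    a = seq x m
    b = seq x n
    open +-*-Solver

  reg-add : (x y : ℝ) → ∀ m n →
    ∣ (seq x (suc (2 ℕ.* m)) + seq y (suc (2 ℕ.* m))) - (seq x (suc (2 ℕ.* n)) + seq y (suc (2 ℕ.* n))) ∣
      ≤ 1/[1+ m ] + 1/[1+ n ]
  reg-add x y m n = begin
    ∣ (a + b) - (c + d) ∣         ≃⟨ ∣-∣-cong (+-*-Solver.solve 4 (λ a b c d → (a :+ b) :+ (:- (c :+ d)) := (a :+ (:- c)) :+ (b :+ (:- d))) ≃-refl a b c d) ⟩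
    ∣ (a - c) + (b - d) ∣         ≤⟨ ∣p+q∣≤∣p∣+∣q∣ (a - c) (b - d) ⟩
    ∣ a - c ∣ + ∣ b - d ∣         ≤⟨ +-mono-≤ (reg x _ _) (reg y _ _) ⟩
    (h m + h n) + (h m + h n)     ≃⟨ +-*-Solver.solve 2 (λ p q → (p :+ q) :+ (p :+ q) := (p :+ p) :+ (q :+ q)) ≃-refl (h m) (h n) ⟩
    (h m + h m) + (h n + h n)     ≃⟨ +-cong (half m) (half n) ⟩
    1/[1+ m ] + 1/[1+ n ] ∎
    where
    a = seq x (suc (2 ℕ.* m))
    b = seq y (suc (2 ℕ.* m))
    c = seq x (suc (2 ℕ.* n))
    d = seq y (suc (2 ℕ.* n))
    open +-*-Solver

-- Bishop's operations: (x + y)_n = x_{2n} + y_{2n},  (-x)_n = -x_n.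
infixl 6 _+ℝ_ _-ℝ_
infix 4 _≈ℝ_ _<ℝ_ _≤ℝ_ _≥ℝ_

0ℝ : ℝ
0ℝ = mkℝ (λ _ → 0ℚᵘ) (λ m n → +-mono-≤ (0≤1/ m) (0≤1/ n))

_+ℝ_ : ℝ → ℝ → ℝ
x +ℝ y = mkℝ (λ k → seq x (suc (2 ℕ.* k)) + seq y (suc (2 ℕ.* k))) (reg-add x y)

-ℝ_ : ℝ → ℝ
-ℝ x = mkℝ (λ k → - seq x k) (reg-neg x)

_-ℝ_ : ℝ → ℝ → ℝ
x -ℝ y = x +ℝ (-ℝ y)

_≈ℝ_ : ℝ → ℝ → Set
x ≈ℝ y = ∀ k → ∣ seq x k - seq y k ∣ ≤ 1/[1+ k ] + 1/[1+ k ]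

Positiveℝ : ℝ → Set
Positiveℝ x = ∃ λ k → 1/[1+ k ] < seq x k

Nonnegativeℝ : ℝ → Set
Nonnegativeℝ x = ∀ k → - 1/[1+ k ] ≤ seq x k

_<ℝ_ : ℝ → ℝ → Set
x <ℝ y = Positiveℝ (y -ℝ x)

_≤ℝ_ : ℝ → ℝ → Set
x ≤ℝ y = Nonnegativeℝ (y -ℝ x)

_≥ℝ_ : ℝ → ℝ → Set
x ≥ℝ y = y ≤ℝ x

record MetricSpace (a ℓ : Level) : Set (lsuc (a ⊔ ℓ)) where
  field
    setoid : Setoid a ℓ
  open Setoid setoid public
  field
    ρ       : Carrier → Carrier → ℝ
    ρ-zero⇒ : ∀ x y → ρ x y ≈ℝ 0ℝ → x ≈ y
    ⇒ρ-zero : ∀ x y → x ≈ y → ρ x y ≈ℝ 0ℝ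
    ρ-sym   : ∀ x y → ρ x y ≈ℝ ρ y x
    ρ-tri   : ∀ x y z → ρ x z ≤ℝ (ρ x y +ℝ ρ y z)

module _ {a ℓ : Level} (M : MetricSpace a ℓ) where
  open MetricSpace M

  record Subset (p : Level) : Set (a ⊔ ℓ ⊔ lsuc p) where
    field
      _∈_   : Carrier → Set p
      ∈-resp : ∀ {x y} → x ≈ y → _∈_ x → _∈_ y
  open Subset public

  _⊆_ : ∀ {p q} → (Carrier → Set p) → (Carrier → Set q) → Set (a ⊔ p ⊔ q)
  S ⊆ T = ∀ x → S x → T x

  IsOpen : ∀ {p} → Subset p → Set (a ⊔ p)
  IsOpen S = ∀ x → _∈_ S x →
    Σ ℝ λ r → (0ℝ <ℝ r) × (∀ y → ρ x y <ℝ r → _∈_ S y)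

  ¬ₛ_ : ∀ {p} → Subset p → Carrier → Set (a ⊔ ℓ ⊔ p)
  (¬ₛ T) x = ∀ y → _∈_ T y → ¬ (x ≈ y)

  BoundedAway : ∀ {p} → Carrier → Subset p → Set (a ⊔ p)
  BoundedAway x T = Σ ℝ λ r → (0ℝ <ℝ r) × (∀ y → _∈_ T y → ρ x y ≥ℝ r)

  -ₛ_ : ∀ {p} → Subset p → Carrier → Set (a ⊔ p)
  (-ₛ T) x = BoundedAway x T

-- If y ∈ T were within the ball of radius r around x ∈ S, then y ∈ S ⊆ ¬T,
-- so y ≠ y; hence ¬ (ρ x y < r). For Bishop reals, ¬ (u < r) already gives
-- r ≤ u, because both relations are read off a single rational at each index
-- and rational order is decidable.
module Submission where

open import Defs
open import Level using (Level)
open import Data.Nat using (ℕ)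
open import Data.Rational.Unnormalised hiding (_⊔_; _⊓_)
open import Data.Rational.Unnormalised.Properties
open import Data.Rational.Unnormalised.Solver
open import Data.Product using (_,_)
open import Relation.Nullary using (¬_; yes; no; contradiction)

neg-[p-q]≃q-p : (p q : ℚᵘ) → - (p - q) ≃ q - p
neg-[p-q]≃q-p = solve 2 (λ p q → :- (p :+ (:- q)) := q :+ (:- p)) ≃-refl
  where open +-*-Solver

≰-neg⇒>-flip : (p q : ℚᵘ) (k : ℕ) → ¬ (- 1/[1+ k ] ≤ p - q) → 1/[1+ k ] < q - p
≰-neg⇒>-flip p q k ≰ =
  <-respʳ-≃ (neg-[p-q]≃q-p p q)
    (<-respˡ-≃ (neg-involutive _) (neg-mono-< (≰⇒> ≰)))

≮ℝ⇒≥ℝ : (u r : ℝ) → ¬ (u <ℝ r) → u ≥ℝ r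
≮ℝ⇒≥ℝ u r u≮r k with - 1/[1+ k ] ≤? seq (u -ℝ r) k
... | yes ok = ok
... | no ≰   = contradiction (k , ≰-neg⇒>-flip (seq u _) (seq r _) k ≰) u≮r

lemma1 : {a ℓ p q : Level} (X : MetricSpace a ℓ)
         (S : Subset X p) (T : Subset X q) →
         _⊆_ X (_∈_ S) (¬ₛ_ X T) → IsOpen X S →
         _⊆_ X (_∈_ S) (-ₛ_ X T)
lemma1 X S T S⊆¬T S-open x x∈S with S-open x x∈S
... | r , r>0 , ball⊆S = r , r>0 , λ y y∈T →
  ≮ℝ⇒≥ℝ (ρ x y) r (λ ρxy<r → S⊆¬T y (ball⊆S y ρxy<r) y y∈T refl)
  where open MetricSpace X using (ρ; refl)
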